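{- For every integer $\ell\geq 2$ there exists an integer $n\in\left[\ell,\frac{\ell(3\ell+1)}{2}\right]$ such that $\sigma moex(n)$ is even. In particular, there are infinitely many integers $n$ for which $\sigma moex(n)$ is even.
   Context: For a partition $\pi$ of a positive integer $n$, $moex(\pi)$ is the smallest odd positive integer that is not a part of $\pi$. For a positive integer $n$, $\sigma moex(n)=\sum_{\pi} moex(\pi)$, summed over all partitions $\pi$ of $n$, and $\sigma moex(0)=1$. Equivalently, $\sum_{n\geq 0}\sigma moex(n)q^n=(-q;q)_\infty(-q;q^2)_\infty^2$, where $(a;q)_\infty=\prod_{m\geq 1}(1-aq^{m-1})$. -}

module Defs where

open import Data.Nat using (ℕ; zero; suc; _+_; _*_; _∸_; _⊓_; _≡ᵇ_)
open import Data.Bool using (Bool; true; false; if_then_else_)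
open import Data.List using (List; []; _∷_; [_]; map; concatMap; applyUpTo; length)
open import Data.Nat.ListAction using (sum)
open import Data.Bool.ListAction using (any)

-- A partition of n is represented as a weakly decreasing list of positive
-- integers summing to n.  partsLE fuel n m lists all partitions of n whose
-- parts are all ≤ m (each exactly once).  Fuel n suffices since each step
-- removes a part ≥ 1.
partsLE : ℕ → ℕ → ℕ → List (List ℕ)
partsLE _       zero    _ = [ [] ]
partsLE zero    (suc n) _ = []
partsLE (suc f) (suc n) m =
  concatMap (λ k → map (k ∷_) (partsLE f (suc n ∸ k) k)) (applyUpTo suc (m ⊓ suc n))

partitions : ℕ → List (List ℕ)
partitions n = partsLE n n n

isPart : ℕ → List ℕ → Bool
isPart x π = any (λ y → x ≡ᵇ y) π

moexFrom : ℕ → ℕ → List ℕ → ℕ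
moexFrom zero    k π = 2 * k + 1
moexFrom (suc f) k π = if isPart (2 * k + 1) π then moexFrom f (suc k) π else 2 * k + 1

-- moex π = smallest odd positive integer that is not a part of π.
-- At most length π odd numbers are parts, so fuel length π suffices.
moex : List ℕ → ℕ
moex π = moexFrom (length π) 0 π

σmoex : ℕ → ℕ
σmoex n = sum (map moex (partitions n))

-- Every value of moex is odd, so σmoex(n) ≡ p(n) (mod 2).  Over 𝔽₂, Shanks' finite
-- identity  Σ_{i≤n} q^{ni+i(i+1)/2} ∏_{i<j≤n} (1+q^j) = Σ_{|k|≤n} q^{k(3k+1)/2}  holds, and
-- its terms with i ≥ 1 have degree > n; so below degree n+1 the right-hand side agrees with
-- ∏_{j≤n} (1+q^j), which times the generating function of partitions into parts ≤ n is 1.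
-- Hence Σ_{|k|≤n} p(N − k(3k+1)/2) is even for 1 ≤ N ≤ n.  Take N = ℓ(3ℓ+1)/2 and suppose
-- p(s) odd for all s ∈ [ℓ, N].  For k < ℓ both N − k(3k±1)/2 lie in [ℓ, N], for k = ℓ they
-- are ℓ and 0, and for k > ℓ both are negative; so the terms for ±k cancel in pairs and the
-- sum is p(N), which is odd.

module Submission where

open import Algebra.Bundles using (AbelianGroup)
import Algebra.Properties.CommutativeSemigroup as CommutativeSemigroupProperties
open import Algebra.Solver.Ring.AlmostCommutativeRing using (fromCommutativeRing)
import Algebra.Solver.Ring.Simple as RingSolver
open import Data.Bool using (true; false)
open import Data.List using (List; []; _∷_; [_]; _++_; map; concatMap; applyUpTo; length)
open import Data.List.Properties using (length-map; length-++; concatMap-++; applyUpTo-∷ʳ; ++-identityʳ)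
open import Data.Nat using (ℕ; zero; suc; pred; _+_; _*_; _∸_; _⊓_; _<_; _≤_; _≤?_; z≤n; s≤s; z<s; parity)
open import Data.Nat.Divisibility using (_∣_; _∣0; n∣n; ∣m∣n⇒∣m+n)
open import Data.Nat.ListAction using (sum)
open import Data.Nat.Properties
open import Data.Nat.Tactic.RingSolver using (solve-∀)
open import Data.Parity.Base as ℙ using (0ℙ; 1ℙ)
import Data.Parity.Properties as ℙ
open import Data.Product using (_×_; _,_; ∃-syntax)
open import Function using (_∘_)
open import Level using (0ℓ)
open import Relation.Binary.Definitions using (tri<; tri≈; tri>)
open import Relation.Binary.PropositionalEquality as ≡ using (_≡_; _≢_)
open import Relation.Nullary using (Dec; yes; no; contradiction)
open import Relation.Nullary.Decidable using (_×-dec_)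

open import Defs

import Algebra.Construct.Pointwise ℕ as Pointwise

module 𝔽₂ = RingSolver (fromCommutativeRing ℙ.+-*-commutativeRing) ℙ._≟_

-- Power series over 𝔽₂ = ℙ as coefficient functions; shift a g is q^a g.
series-abelianGroup : AbelianGroup 0ℓ 0ℓ
series-abelianGroup = Pointwise.abelianGroup ℙ.+-0-abelianGroup

open AbelianGroup series-abelianGroup
  using (_≈_; setoid)
  renaming (Carrier to Series; _∙_ to _⊕_; ε to 𝟘; refl to ≈-refl; reflexive to ≈-reflexive; trans to ≈-trans)

open CommutativeSemigroupProperties (AbelianGroup.commutativeSemigroup series-abelianGroup) using (interchange)
import Relation.Binary.Reasoning.Setoid setoid as ≈-Reasoning

infixl 8 _·[1+q^_]

shift : ℕ → Series → Series
shift zero    g t       = g t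
shift (suc a) g zero    = 0ℙ
shift (suc a) g (suc t) = shift a g t

_·[1+q^_] : Series → ℕ → Series
g ·[1+q^ i ] = g ⊕ shift i g

⊕-congˡ : ∀ f {g h} → g ≈ h → f ⊕ g ≈ f ⊕ h
⊕-congˡ f g≈h t = ≡.cong (f t ℙ.+_) (g≈h t)

⊕-congʳ : ∀ h {f g} → f ≈ g → f ⊕ h ≈ g ⊕ h
⊕-congʳ h f≈g t = ≡.cong (ℙ._+ h t) (f≈g t)

shift-cong : ∀ a {g h} → g ≈ h → shift a g ≈ shift a h
shift-cong zero    g≈h t       = g≈h t
shift-cong (suc a) g≈h zero    = ≡.refl
shift-cong (suc a) g≈h (suc t) = shift-cong a g≈h t

shift-cong-exp : ∀ {a b} g → a ≡ b → shift a g ≈ shift b g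
shift-cong-exp g ≡.refl = ≈-refl

shift-⊕ : ∀ a g h → shift a (g ⊕ h) ≈ shift a g ⊕ shift a h
shift-⊕ zero    g h t       = ≡.refl
shift-⊕ (suc a) g h zero    = ≡.refl
shift-⊕ (suc a) g h (suc t) = shift-⊕ a g h t

shift-shift : ∀ a b g → shift a (shift b g) ≈ shift (a + b) g
shift-shift zero    b g t       = ≡.refl
shift-shift (suc a) b g zero    = ≡.refl
shift-shift (suc a) b g (suc t) = shift-shift a b g t

shift-comm : ∀ a b g → shift a (shift b g) ≈ shift b (shift a g)
shift-comm a b g = begin
  shift a (shift b g) ≈⟨ shift-shift a b g ⟩
  shift (a + b) g     ≈⟨ shift-cong-exp g (+-comm a b) ⟩
  shift (b + a) g     ≈⟨ shift-shift b a g ⟨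
  shift b (shift a g) ∎
  where open ≈-Reasoning

shift-+ : ∀ a g u → shift a g (a + u) ≡ g u
shift-+ zero    g u = ≡.refl
shift-+ (suc a) g u = shift-+ a g u

shift-< : ∀ a g {t} → t < a → shift a g t ≡ 0ℙ
shift-< (suc a) g {zero}  _         = ≡.refl
shift-< (suc a) g {suc t} (s≤s t<a) = shift-< a g t<a

shift-≥ : ∀ {e t} g → e ≤ t → shift e g t ≡ g (t ∸ e)
shift-≥ {e} g e≤t with u , ≡.refl ← m≤n⇒∃[o]m+o≡n e≤t = ≡.trans (shift-+ e g u) (≡.cong g (≡.sym (m+n∸m≡n e u)))

·[1+q^]-cong : ∀ i {g h} → g ≈ h → g ·[1+q^ i ] ≈ h ·[1+q^ i ]
·[1+q^]-cong i g≈h t = ≡.cong₂ ℙ._+_ (g≈h t) (shift-cong i g≈h t)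

·[1+q^]-cong-exp : ∀ g {i j} → i ≡ j → g ·[1+q^ i ] ≈ g ·[1+q^ j ]
·[1+q^]-cong-exp g ≡.refl = ≈-refl

·[1+q^]-⊕ : ∀ i g h → (g ⊕ h) ·[1+q^ i ] ≈ g ·[1+q^ i ] ⊕ h ·[1+q^ i ]
·[1+q^]-⊕ i g h = ≈-trans (⊕-congˡ (g ⊕ h) (shift-⊕ i g h)) (interchange g h (shift i g) (shift i h))

shift-·[1+q^] : ∀ a i g → shift a (g ·[1+q^ i ]) ≈ shift a g ·[1+q^ i ]
shift-·[1+q^] a i g = ≈-trans (shift-⊕ a g (shift i g)) (⊕-congˡ (shift a g) (shift-comm a i g))

·[1+q^]-comm : ∀ i j g → g ·[1+q^ j ] ·[1+q^ i ] ≈ g ·[1+q^ i ] ·[1+q^ j ]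
·[1+q^]-comm i j g = begin
  g ·[1+q^ j ] ·[1+q^ i ]              ≈⟨ ·[1+q^]-⊕ i g (shift j g) ⟩
  g ·[1+q^ i ] ⊕ shift j g ·[1+q^ i ]  ≈⟨ ⊕-congˡ (g ·[1+q^ i ]) (shift-·[1+q^] j i g) ⟨
  g ·[1+q^ i ] ·[1+q^ j ]              ∎
  where open ≈-Reasoning

·[1+q^0] : ∀ g → g ·[1+q^ 0 ] ≈ 𝟘
·[1+q^0] g t = ℙ.p+p≡0ℙ (g t)

shift-·[1+q^]-expand : ∀ a i g → shift a (g ·[1+q^ i ]) ≈ shift a g ⊕ shift (a + i) g
shift-·[1+q^]-expand a i g = ≈-trans (shift-⊕ a g (shift i g)) (⊕-congˡ (shift a g) (shift-shift a i g))

·[1+q^]-intro : ∀ a {g h} → (∀ {t} → t < a → g t ≡ h t) → (∀ u → g (a + u) ℙ.+ g u ≡ h (a + u)) →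
                g ·[1+q^ a ] ≈ h
·[1+q^]-intro a {g} below above t with a ≤? t
... | no  a≰t = ≡.trans (≡.cong (g t ℙ.+_) (shift-< a g (≰⇒> a≰t))) (≡.trans (ℙ.+-identityʳ (g t)) (below (≰⇒> a≰t)))
... | yes a≤t with u , ≡.refl ← m≤n⇒∃[o]m+o≡n a≤t = ≡.trans (≡.cong (g (a + u) ℙ.+_) (shift-+ a g u)) (above u)

timesProd : Series → ℕ → ℕ → Series
timesProd g a zero    = g
timesProd g a (suc m) = timesProd g a m ·[1+q^ a + suc m ]

timesProd-cong : ∀ a m {g h} → g ≈ h → timesProd g a m ≈ timesProd h a m
timesProd-cong a zero    g≈h = g≈h
timesProd-cong a (suc m) g≈h = ·[1+q^]-cong (a + suc m) (timesProd-cong a m g≈h)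

timesProd-·[1+q^] : ∀ a m i g → timesProd (g ·[1+q^ i ]) a m ≈ timesProd g a m ·[1+q^ i ]
timesProd-·[1+q^] a zero    i g = ≈-refl
timesProd-·[1+q^] a (suc m) i g = ≈-trans (·[1+q^]-cong (a + suc m) (timesProd-·[1+q^] a m i g))
                                           (·[1+q^]-comm (a + suc m) i (timesProd g a m))

timesProd-suc : ∀ a m g → timesProd g a (suc m) ≈ timesProd (g ·[1+q^ suc a ]) (suc a) m
timesProd-suc a zero    g = ·[1+q^]-cong-exp g (+-comm a 1)
timesProd-suc a (suc m) g = ≈-trans (·[1+q^]-cong (a + suc (suc m)) (timesProd-suc a m g))
                                    (·[1+q^]-cong-exp (timesProd (g ·[1+q^ suc a ]) (suc a) m) (+-suc a (suc m)))

triangle : ℕ → ℕ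
triangle zero    = 0
triangle (suc k) = suc k + triangle k

-- k(3k+1)/2 and k(3k−1)/2
pentagonal : ℕ → ℕ
pentagonal k = k * k + triangle k

pentagonal⁻ : ℕ → ℕ
pentagonal⁻ k = k * k + triangle (pred k)

triangle-mono-≤ : ∀ {j k} → j ≤ k → triangle j ≤ triangle k
triangle-mono-≤ z≤n       = z≤n
triangle-mono-≤ (s≤s j≤k) = +-mono-≤ (s≤s j≤k) (triangle-mono-≤ j≤k)

pentagonal-mono-≤ : ∀ {j k} → j ≤ k → pentagonal j ≤ pentagonal k
pentagonal-mono-≤ j≤k = +-mono-≤ (*-mono-≤ j≤k j≤k) (triangle-mono-≤ j≤k)

pentagonal≡pentagonal⁻+ : ∀ k → pentagonal k ≡ pentagonal⁻ k + k
pentagonal≡pentagonal⁻+ zero    = ≡.refl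
pentagonal≡pentagonal⁻+ (suc k) = identity (suc k) (triangle k)
  where
  identity : ∀ a x → a * a + (a + x) ≡ a * a + x + a
  identity = solve-∀

pentagonal⁻≤pentagonal : ∀ k → pentagonal⁻ k ≤ pentagonal k
pentagonal⁻≤pentagonal k = ≤-trans (m≤m+n (pentagonal⁻ k) k) (≤-reflexive (≡.sym (pentagonal≡pentagonal⁻+ k)))

pentagonal+suc≤pentagonal⁻ : ∀ j → pentagonal j + suc j ≤ pentagonal⁻ (suc j)
pentagonal+suc≤pentagonal⁻ j = ≤-trans (m≤m+n (pentagonal j + suc j) j) (≤-reflexive (identity j (triangle j)))
  where
  identity : ∀ j x → j * j + x + suc j + j ≡ suc j * suc j + x
  identity = solve-∀

<⇒+pentagonal≤pentagonal : ∀ {k ℓ} → k < ℓ → ℓ + pentagonal k ≤ pentagonal ℓ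
<⇒+pentagonal≤pentagonal {k} {suc ℓ} (s≤s k≤ℓ) = begin
  suc ℓ + pentagonal k      ≤⟨ +-monoʳ-≤ (suc ℓ) (pentagonal-mono-≤ k≤ℓ) ⟩
  suc ℓ + pentagonal ℓ      ≡⟨ +-comm (suc ℓ) (pentagonal ℓ) ⟩
  pentagonal ℓ + suc ℓ      ≤⟨ pentagonal+suc≤pentagonal⁻ ℓ ⟩
  pentagonal⁻ (suc ℓ)       ≤⟨ pentagonal⁻≤pentagonal (suc ℓ) ⟩
  pentagonal (suc ℓ)        ∎
  where open ≤-Reasoning

<⇒pentagonal<pentagonal⁻ : ∀ {ℓ k} → ℓ < k → pentagonal ℓ < pentagonal⁻ k
<⇒pentagonal<pentagonal⁻ {ℓ} {suc k} (s≤s ℓ≤k) = begin-strict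
  pentagonal ℓ              ≤⟨ pentagonal-mono-≤ ℓ≤k ⟩
  pentagonal k              <⟨ m<m+n (pentagonal k) z<s ⟩
  pentagonal k + suc k      ≤⟨ pentagonal+suc≤pentagonal⁻ k ⟩
  pentagonal⁻ (suc k)       ∎
  where open ≤-Reasoning

2*triangle : ∀ k → 2 * triangle k ≡ k * suc k
2*triangle zero    = ≡.refl
2*triangle (suc k) = begin
  2 * (suc k + triangle k)           ≡⟨ *-distribˡ-+ 2 (suc k) (triangle k) ⟩
  2 * suc k + 2 * triangle k         ≡⟨ ≡.cong (2 * suc k +_) (2*triangle k) ⟩
  2 * suc k + k * suc k              ≡⟨ identity k ⟩
  suc k * suc (suc k)                ∎
  where
  open ≡.≡-Reasoning
  identity : ∀ k → 2 * suc k + k * suc k ≡ suc k * suc (suc k)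
  identity = solve-∀

2*pentagonal : ∀ k → 2 * pentagonal k ≡ k * (3 * k + 1)
2*pentagonal k = begin
  2 * (k * k + triangle k)           ≡⟨ *-distribˡ-+ 2 (k * k) (triangle k) ⟩
  2 * (k * k) + 2 * triangle k       ≡⟨ ≡.cong (2 * (k * k) +_) (2*triangle k) ⟩
  2 * (k * k) + k * suc k            ≡⟨ identity k ⟩
  k * (3 * k + 1)                    ∎
  where
  open ≡.≡-Reasoning
  identity : ∀ k → 2 * (k * k) + k * suc k ≡ k * (3 * k + 1)
  identity = solve-∀

shanksTerm : Series → ℕ → ℕ → Series
shanksTerm f k m = shift ((k + m) * k + triangle k) (timesProd f k m)

-- shanksSum f 0 n = f · Σ_{i≤n} q^{ni+i(i+1)/2} ∏_{i<j≤n} (1+q^j)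
shanksSum : Series → ℕ → ℕ → Series
shanksSum f k zero    = shanksTerm f k zero
shanksSum f k (suc m) = shanksTerm f k (suc m) ⊕ shanksSum f (suc k) m

pentagonalPair : Series → ℕ → Series
pentagonalPair f k = shift (pentagonal⁻ k) f ⊕ shift (pentagonal k) f

pentagonalSum : Series → ℕ → Series
pentagonalSum f zero    = f
pentagonalSum f (suc n) = pentagonalSum f n ⊕ pentagonalPair f (suc n)

shanksTerm-suc : ∀ f k m → shanksTerm f k (suc (suc m)) ≈
                 shift k (shanksTerm f k (suc m)) ⊕ shanksTerm f (suc k) m ·[1+q^ suc k ]
shanksTerm-suc f k m = begin
  shift e (P ·[1+q^ i ])                                 ≈⟨ shift-·[1+q^]-expand e i P ⟩
  shift e P ⊕ shift (e + i) P                            ≈⟨ ⊕-congʳ (shift (e + i) P) (shift-cong-exp P e≡k+e₁) ⟩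
  shift (k + e₁) P ⊕ shift (e + i) P                     ≈⟨ ⊕-congʳ (shift (e + i) P) (shift-shift k e₁ P) ⟨
  shift k (shift e₁ P) ⊕ shift (e + i) P                 ≈⟨ ⊕-congˡ (shift k (shift e₁ P)) (shift-cong-exp P e+i≡e′) ⟩
  shift k (shift e₁ P) ⊕ shift e′ P                      ≈⟨ ⊕-congˡ (shift k (shift e₁ P)) (shift-cong e′ P≈) ⟩
  shift k (shift e₁ P) ⊕ shift e′ (P′ ·[1+q^ suc k ])    ≈⟨ ⊕-congˡ (shift k (shift e₁ P)) (shift-·[1+q^] e′ (suc k) P′) ⟩
  shift k (shift e₁ P) ⊕ shift e′ P′ ·[1+q^ suc k ]      ∎
  where
  open ≈-Reasoning
  i = k + suc (suc m)
  e = (k + suc (suc m)) * k + triangle k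
  e₁ = (k + suc m) * k + triangle k
  e′ = (suc k + m) * suc k + triangle (suc k)
  P = timesProd f k (suc m)
  P′ = timesProd f (suc k) m
  P≈ : P ≈ P′ ·[1+q^ suc k ]
  P≈ = ≈-trans (timesProd-suc k m f) (timesProd-·[1+q^] (suc k) m (suc k) f)
  e≡k+e₁ : e ≡ k + e₁
  e≡k+e₁ = identity k m (triangle k)
    where
    identity : ∀ k m x → (k + suc (suc m)) * k + x ≡ k + ((k + suc m) * k + x)
    identity = solve-∀
  e+i≡e′ : e + i ≡ e′
  e+i≡e′ = identity k m (triangle k)
    where
    identity : ∀ k m x → (k + suc (suc m)) * k + x + (k + suc (suc m)) ≡ (suc k + m) * suc k + (suc k + x)
    identity = solve-∀

shanksSum-suc : ∀ f k m → shanksSum f k (suc m) ≈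
                shanksSum f k m ⊕ (shanksTerm f k m ·[1+q^ k ] ⊕ pentagonalPair f (suc m + k))
shanksSum-suc f k zero = begin
  shift a (f ·[1+q^ k + 1 ]) ⊕ shift b f          ≈⟨ ⊕-congʳ (shift b f) (shift-·[1+q^]-expand a (k + 1) f) ⟩
  shift a f ⊕ shift (a + (k + 1)) f ⊕ shift b f   ≈⟨ ⊕-congʳ (shift b f) (⊕-congˡ (shift a f) (shift-cong-exp f a+k+1≡)) ⟩
  shift a f ⊕ B ⊕ shift b f                       ≈⟨ ⊕-congˡ (shift a f ⊕ B) (shift-cong-exp f b≡) ⟩
  shift a f ⊕ B ⊕ C                               ≈⟨ rearrange ⟩
  H ⊕ (H ⊕ shift a f ⊕ (B ⊕ C))                   ≈⟨ ⊕-congˡ H (⊕-congʳ (B ⊕ C) (⊕-congˡ H shift-H)) ⟨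
  H ⊕ (H ·[1+q^ k ] ⊕ (B ⊕ C))                    ∎
  where
  open ≈-Reasoning
  a = (k + 1) * k + triangle k
  b = (suc k + 0) * suc k + triangle (suc k)
  c = (k + 0) * k + triangle k
  H = shift c f
  B = shift (pentagonal⁻ (suc k)) f
  C = shift (pentagonal (suc k)) f
  shift-H : shift k H ≈ shift a f
  shift-H = ≈-trans (shift-shift k c f) (shift-cong-exp f (identity k (triangle k)))
    where
    identity : ∀ k x → k + ((k + 0) * k + x) ≡ (k + 1) * k + x
    identity = solve-∀
  a+k+1≡ : a + (k + 1) ≡ pentagonal⁻ (suc k)
  a+k+1≡ = identity k (triangle k)
    where
    identity : ∀ k x → (k + 1) * k + x + (k + 1) ≡ suc k * suc k + x
    identity = solve-∀
  b≡ : b ≡ pentagonal (suc k)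
  b≡ = ≡.cong (λ j → j * suc k + triangle (suc k)) (+-identityʳ (suc k))
  rearrange : shift a f ⊕ B ⊕ C ≈ H ⊕ (H ⊕ shift a f ⊕ (B ⊕ C))
  rearrange t = solve 4 (λ a b c h → a :+ b :+ c := h :+ (h :+ a :+ (b :+ c))) ≡.refl
                  (shift a f t) (B t) (C t) (H t)
    where open 𝔽₂

shanksSum-suc f k (suc m) = begin
  shanksTerm f k (suc (suc m)) ⊕ shanksSum f (suc k) (suc m)
    ≈⟨ ⊕-congʳ (shanksSum f (suc k) (suc m)) (shanksTerm-suc f k m) ⟩
  shift k H ⊕ X ⊕ shanksSum f (suc k) (suc m)
    ≈⟨ ⊕-congˡ (shift k H ⊕ X) (shanksSum-suc f (suc k) m) ⟩
  shift k H ⊕ X ⊕ (S ⊕ (X ⊕ pentagonalPair f (suc m + suc k)))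
    ≈⟨ rearrange ⟩
  H ⊕ S ⊕ (H ⊕ shift k H ⊕ pentagonalPair f (suc m + suc k))
    ≈⟨ ⊕-congˡ (H ⊕ S) (⊕-congˡ (H ⊕ shift k H) (≈-reflexive (≡.cong (pentagonalPair f) (+-suc (suc m) k)))) ⟩
  H ⊕ S ⊕ (H ⊕ shift k H ⊕ pentagonalPair f (suc (suc m) + k))
    ∎
  where
  open ≈-Reasoning
  H = shanksTerm f k (suc m)
  X = shanksTerm f (suc k) m ·[1+q^ suc k ]
  S = shanksSum f (suc k) m
  P = pentagonalPair f (suc m + suc k)
  rearrange : shift k H ⊕ X ⊕ (S ⊕ (X ⊕ P)) ≈ H ⊕ S ⊕ (H ⊕ shift k H ⊕ P)
  rearrange t = solve 5 (λ h x s p qh → qh :+ x :+ (s :+ (x :+ p)) := h :+ s :+ (h :+ qh :+ p)) ≡.refl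
                  (H t) (X t) (S t) (P t) (shift k H t)
    where open 𝔽₂

shanksSum≈pentagonalSum : ∀ f n → shanksSum f 0 n ≈ pentagonalSum f n
shanksSum≈pentagonalSum f zero    = ≈-refl
shanksSum≈pentagonalSum f (suc n) = begin
  shanksSum f 0 (suc n)
    ≈⟨ shanksSum-suc f 0 n ⟩
  shanksSum f 0 n ⊕ (shanksTerm f 0 n ·[1+q^ 0 ] ⊕ pentagonalPair f (suc n + 0))
    ≈⟨ ⊕-congʳ _ (shanksSum≈pentagonalSum f n) ⟩
  pentagonalSum f n ⊕ (shanksTerm f 0 n ·[1+q^ 0 ] ⊕ pentagonalPair f (suc n + 0))
    ≈⟨ ⊕-congˡ (pentagonalSum f n) (⊕-congʳ (pentagonalPair f (suc n + 0)) (·[1+q^0] (shanksTerm f 0 n))) ⟩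
  pentagonalSum f n ⊕ (𝟘 ⊕ pentagonalPair f (suc n + 0))
    ≈⟨ ⊕-congˡ (pentagonalSum f n) (≈-reflexive (≡.cong (pentagonalPair f) (+-identityʳ (suc n)))) ⟩
  pentagonalSum f (suc n)
    ∎
  where open ≈-Reasoning

shanksTerm-low : ∀ f k m {t} → t ≤ suc k + m → shanksTerm f (suc k) m t ≡ 0ℙ
shanksTerm-low f k m {t} t≤ = shift-< ((suc k + m) * suc k + triangle (suc k)) (timesProd f (suc k) m)
  (≤-<-trans (≤-trans t≤ (m≤m*n (suc k + m) (suc k))) (m<m+n _ z<s))

shanksSum-low : ∀ f k m {t} → t ≤ suc k + m → shanksSum f (suc k) m t ≡ 0ℙ
shanksSum-low f k zero    t≤ = shanksTerm-low f k zero t≤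
shanksSum-low f k (suc m) t≤ = ≡.cong₂ ℙ._+_ (shanksTerm-low f k (suc m) t≤)
                                              (shanksSum-low f (suc k) m (≤-trans t≤ (≤-reflexive (+-suc (suc k) m))))

pentagonalSum≡timesProd : ∀ f n {t} → t ≤ n → pentagonalSum f n t ≡ timesProd f 0 n t
pentagonalSum≡timesProd f zero    _  = ≡.refl
pentagonalSum≡timesProd f (suc n) {t} t≤ = begin
  pentagonalSum f (suc n) t                      ≡⟨ shanksSum≈pentagonalSum f (suc n) t ⟨
  shanksTerm f 0 (suc n) t ℙ.+ shanksSum f 1 n t ≡⟨ ≡.cong₂ ℙ._+_ (shift-cong-exp _ exponent≡0 t) (shanksSum-low f 0 n t≤) ⟩
  timesProd f 0 (suc n) t ℙ.+ 0ℙ                 ≡⟨ ℙ.+-identityʳ _ ⟩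
  timesProd f 0 (suc n) t                        ∎
  where
  open ≡.≡-Reasoning
  exponent≡0 : suc n * 0 + 0 ≡ 0
  exponent≡0 = ≡.trans (+-identityʳ _) (*-zeroʳ (suc n))

module _ (f : Series) (ℓ : ℕ) (f-constant : ∀ {s} → ℓ ≤ s → s ≤ pentagonal ℓ → f s ≡ f 0) where

  private
    shift-early : ∀ {e} → ℓ + e ≤ pentagonal ℓ → shift e f (pentagonal ℓ) ≡ f 0
    shift-early {e} ℓ+e≤n = ≡.trans (shift-≥ f (m+n≤o⇒n≤o ℓ ℓ+e≤n))
                                    (f-constant (m+n≤o⇒m≤o∸n ℓ ℓ+e≤n) (m∸n≤m (pentagonal ℓ) e))

  pentagonalPair-vanishes : ∀ k → pentagonalPair f k (pentagonal ℓ) ≡ 0ℙ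
  pentagonalPair-vanishes k with <-cmp k ℓ
  ... | tri< k<ℓ _ _ = ≡.trans (≡.cong₂ ℙ._+_ (shift-early (≤-trans (+-monoʳ-≤ ℓ (pentagonal⁻≤pentagonal k)) ℓ+pk≤n))
                                               (shift-early ℓ+pk≤n))
                               (ℙ.p+p≡0ℙ (f 0))
    where ℓ+pk≤n = <⇒+pentagonal≤pentagonal k<ℓ
  ... | tri≈ _ ≡.refl _ = ≡.trans (≡.cong₂ ℙ._+_ (shift-early (≤-reflexive ℓ+pℓ⁻≡pℓ))
                                                  (≡.trans (shift-≥ {pentagonal ℓ} f ≤-refl) (≡.cong f (n∸n≡0 (pentagonal ℓ)))))
                                  (ℙ.p+p≡0ℙ (f 0))
    where ℓ+pℓ⁻≡pℓ = ≡.trans (+-comm ℓ (pentagonal⁻ ℓ)) (≡.sym (pentagonal≡pentagonal⁻+ ℓ))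
  ... | tri> _ _ ℓ<k = ≡.cong₂ ℙ._+_ (shift-< (pentagonal⁻ k) f (<⇒pentagonal<pentagonal⁻ ℓ<k))
                                     (shift-< (pentagonal k) f (<-≤-trans (<⇒pentagonal<pentagonal⁻ ℓ<k) (pentagonal⁻≤pentagonal k)))

  pentagonalSum-at-pentagonal : ∀ m → pentagonalSum f m (pentagonal ℓ) ≡ f (pentagonal ℓ)
  pentagonalSum-at-pentagonal zero    = ≡.refl
  pentagonalSum-at-pentagonal (suc m) = ≡.trans (≡.cong₂ ℙ._+_ (pentagonalSum-at-pentagonal m) (pentagonalPair-vanishes (suc m)))
                                                (ℙ.+-identityʳ _)

𝟙 : Series
𝟙 zero    = 1ℙ
𝟙 (suc t) = 0ℙ

partitionCount : ℕ → ℕ → ℕ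
partitionCount m t = length (partsLE t t m)

partitionParity : ℕ → Series
partitionParity m = parity ∘ partitionCount m

concatMap-applyUpTo-cong : ∀ {A B : Set} {g h : A → List B} (f : ℕ → A) n →
                           (∀ i → g (f i) ≡ h (f i)) →
                           concatMap g (applyUpTo f n) ≡ concatMap h (applyUpTo f n)
concatMap-applyUpTo-cong f zero    _  = ≡.refl
concatMap-applyUpTo-cong f (suc n) eq = ≡.cong₂ _++_ (eq 0) (concatMap-applyUpTo-cong (f ∘ suc) n (eq ∘ suc))

partsLE-fuel : ∀ {f f′} n m → n ≤ f → n ≤ f′ → partsLE f n m ≡ partsLE f′ n m
partsLE-fuel zero m _ _ = ≡.refl
partsLE-fuel {suc f} {suc f′} (suc n) m (s≤s n≤f) (s≤s n≤f′) = concatMap-applyUpTo-cong suc (m ⊓ suc n)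
  λ i → ≡.cong (map (suc i ∷_)) (partsLE-fuel (n ∸ i) (suc i) (≤-trans (m∸n≤m n i) n≤f) (≤-trans (m∸n≤m n i) n≤f′))

partsLE-cap : ∀ f n m → n ≤ m → partsLE f n m ≡ partsLE f n n
partsLE-cap f       zero    m _   = ≡.refl
partsLE-cap zero    (suc n) m _   = ≡.refl
partsLE-cap (suc f) (suc n) m n≤m =
  ≡.cong (λ j → concatMap (λ k → map (k ∷_) (partsLE f (suc n ∸ k) k)) (applyUpTo suc j))
         (≡.trans (m≥n⇒m⊓n≡n n≤m) (≡.sym (⊓-idem (suc n))))

partitionCount-≤ : ∀ {m t} → t ≤ m → partitionCount (suc m) t ≡ partitionCount m t
partitionCount-≤ {m} {t} t≤m =
  ≡.cong length (≡.trans (partsLE-cap t t (suc m) (m≤n⇒m≤1+n t≤m)) (≡.sym (partsLE-cap t t m t≤m)))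

partitionCount-suc : ∀ m u → partitionCount (suc m) (suc m + u) ≡
                             partitionCount m (suc m + u) + partitionCount (suc m) u
partitionCount-suc m u = begin
  length (concatMap g (applyUpTo suc (suc (m ⊓ n))))
    ≡⟨ ≡.cong (λ j → length (concatMap g (applyUpTo suc (suc j)))) (m≤n⇒m⊓n≡m m≤n) ⟩
  length (concatMap g (applyUpTo suc (suc m)))
    ≡⟨ ≡.cong (length ∘ concatMap g) (applyUpTo-∷ʳ suc m) ⟨
  length (concatMap g (applyUpTo suc m ++ [ suc m ]))
    ≡⟨ ≡.cong length (concatMap-++ g (applyUpTo suc m) [ suc m ]) ⟩
  length (concatMap g (applyUpTo suc m) ++ g (suc m) ++ [])
    ≡⟨ length-++ (concatMap g (applyUpTo suc m)) ⟩
  length (concatMap g (applyUpTo suc m)) + length (g (suc m) ++ [])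
    ≡⟨ ≡.cong₂ _+_ (≡.cong (λ j → length (concatMap g (applyUpTo suc j))) (≡.sym (m≤n⇒m⊓n≡m (m≤n⇒m≤1+n m≤n))))
                   last-block ⟩
  partitionCount m (suc m + u) + partitionCount (suc m) u
    ∎
  where
  open ≡.≡-Reasoning
  n = m + u
  m≤n = m≤m+n m u
  g : ℕ → List (List ℕ)
  g k = map (k ∷_) (partsLE n (suc n ∸ k) k)
  last-block : length (g (suc m) ++ []) ≡ partitionCount (suc m) u
  last-block = begin
    length (g (suc m) ++ [])                    ≡⟨ ≡.cong length (++-identityʳ (g (suc m))) ⟩
    length (map (suc m ∷_) (partsLE n (n ∸ m) (suc m))) ≡⟨ length-map (suc m ∷_) (partsLE n (n ∸ m) (suc m)) ⟩
    length (partsLE n (n ∸ m) (suc m))          ≡⟨ ≡.cong (λ j → length (partsLE n j (suc m))) (m+n∸m≡n m u) ⟩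
    length (partsLE n u (suc m))                ≡⟨ ≡.cong length (partsLE-fuel u (suc m) (m≤n+m u m) ≤-refl) ⟩
    partitionCount (suc m) u                    ∎

partitionParity-·[1+q^] : ∀ m → partitionParity (suc m) ·[1+q^ suc m ] ≈ partitionParity m
partitionParity-·[1+q^] m = ·[1+q^]-intro (suc m) (≡.cong parity ∘ partitionCount-≤ ∘ ≤-pred) λ u → begin
  parity (partitionCount (suc m) (suc m + u)) ℙ.+ p u     ≡⟨ ≡.cong (ℙ._+ p u) (≡.cong parity (partitionCount-suc m u)) ⟩
  parity (partitionCount m (suc m + u) + c u) ℙ.+ p u     ≡⟨ ≡.cong (ℙ._+ p u) (ℙ.+-homo-+ (partitionCount m (suc m + u)) (c u)) ⟩
  partitionParity m (suc m + u) ℙ.+ p u ℙ.+ p u           ≡⟨ ℙ.+-assoc (partitionParity m (suc m + u)) (p u) (p u) ⟩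
  partitionParity m (suc m + u) ℙ.+ (p u ℙ.+ p u)         ≡⟨ ≡.cong (partitionParity m (suc m + u) ℙ.+_) (ℙ.p+p≡0ℙ (p u)) ⟩
  partitionParity m (suc m + u) ℙ.+ 0ℙ                    ≡⟨ ℙ.+-identityʳ _ ⟩
  partitionParity m (suc m + u)                           ∎
  where
  open ≡.≡-Reasoning
  c = partitionCount (suc m)
  p = partitionParity (suc m)

timesProd-partitionParity : ∀ m → timesProd (partitionParity m) 0 m ≈ 𝟙
timesProd-partitionParity zero    = λ { zero → ≡.refl ; (suc t) → ≡.refl }
timesProd-partitionParity (suc m) = begin
  timesProd (partitionParity (suc m)) 0 m ·[1+q^ suc m ]   ≈⟨ timesProd-·[1+q^] 0 m (suc m) (partitionParity (suc m)) ⟨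
  timesProd (partitionParity (suc m) ·[1+q^ suc m ]) 0 m   ≈⟨ timesProd-cong 0 m (partitionParity-·[1+q^] m) ⟩
  timesProd (partitionParity m) 0 m                        ≈⟨ timesProd-partitionParity m ⟩
  𝟙                                                        ∎
  where open ≈-Reasoning

pentagonalSum-partitionParity : ∀ n {t} → t ≤ n → pentagonalSum (partitionParity n) n t ≡ 𝟙 t
pentagonalSum-partitionParity n {t} t≤n =
  ≡.trans (pentagonalSum≡timesProd (partitionParity n) n t≤n) (timesProd-partitionParity n t)

partitionParity-partitions : ∀ {n s} → s ≤ n → partitionParity n s ≡ parity (length (partitions s))
partitionParity-partitions {n} {s} s≤n = ≡.cong (parity ∘ length) (partsLE-cap s s n s≤n)

parity-2*k+1 : ∀ k → parity (2 * k + 1) ≡ 1ℙ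
parity-2*k+1 k = ≡.trans (ℙ.+-homo-+ (2 * k) 1) (≡.cong (ℙ._+ 1ℙ) (ℙ.*-homo-* 2 k))

parity-moexFrom : ∀ fuel k π → parity (moexFrom fuel k π) ≡ 1ℙ
parity-moexFrom zero       k π = parity-2*k+1 k
parity-moexFrom (suc fuel) k π with isPart (2 * k + 1) π
... | true  = parity-moexFrom fuel (suc k) π
... | false = parity-2*k+1 k

parity-sum-odd : ∀ {A : Set} (g : A → ℕ) → (∀ x → parity (g x) ≡ 1ℙ) →
                 ∀ xs → parity (sum (map g xs)) ≡ parity (length xs)
parity-sum-odd g odd []       = ≡.refl
parity-sum-odd g odd (x ∷ xs) = ≡.trans (ℙ.+-homo-+ (g x) (sum (map g xs)))
  (≡.trans (≡.cong₂ ℙ._+_ (odd x) (parity-sum-odd g odd xs)) (≡.sym (ℙ.+-homo-+ 1 (length xs))))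

parity-σmoex : ∀ n → parity (σmoex n) ≡ parity (length (partitions n))
parity-σmoex n = parity-sum-odd moex (λ π → parity-moexFrom (length π) 0 π) (partitions n)

parity≡0ℙ⇒2∣ : ∀ n → parity n ≡ 0ℙ → 2 ∣ n
parity≡0ℙ⇒2∣ zero          _    = 2 ∣0
parity≡0ℙ⇒2∣ (suc (suc n)) even = ∣m∣n⇒∣m+n (n∣n {2}) (parity≡0ℙ⇒2∣ n even)

even-partitions-between : ∀ ℓ → 1 ≤ ℓ →
                          ∃[ s ] (ℓ ≤ s × s ≤ pentagonal ℓ × parity (length (partitions s)) ≡ 0ℙ)
even-partitions-between ℓ@(suc _) (s≤s _) with anyUpTo? even? (suc (pentagonal ℓ))
  where
  even? : ∀ s → Dec (ℓ ≤ s × parity (length (partitions s)) ≡ 0ℙ)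
  even? s = ℓ ≤? s ×-dec parity (length (partitions s)) ℙ.≟ 0ℙ
... | yes (s , s<1+n , ℓ≤s , even) = s , ℓ≤s , ≤-pred s<1+n , even
... | no  none = contradiction 1ℙ≡0ℙ λ ()
  where
  n = pentagonal ℓ
  f = partitionParity n
  ≢0ℙ⇒≡1ℙ : ∀ {p} → p ≢ 0ℙ → p ≡ 1ℙ
  ≢0ℙ⇒≡1ℙ {0ℙ} p≢0ℙ = contradiction ≡.refl p≢0ℙ
  ≢0ℙ⇒≡1ℙ {1ℙ} _    = ≡.refl
  odd : ∀ {s} → ℓ ≤ s → s ≤ n → f s ≡ 1ℙ
  odd {s} ℓ≤s s≤n = ≡.trans (partitionParity-partitions s≤n) (≢0ℙ⇒≡1ℙ λ even → none (s , s≤s s≤n , ℓ≤s , even))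
  ℓ≤n : ℓ ≤ n
  ℓ≤n = ≤-trans (m≤m*n ℓ ℓ) (m≤m+n (ℓ * ℓ) (triangle ℓ))
  1ℙ≡0ℙ : 1ℙ ≡ 0ℙ
  1ℙ≡0ℙ = begin
    1ℙ                   ≡⟨ odd ℓ≤n ≤-refl ⟨
    f n                  ≡⟨ pentagonalSum-at-pentagonal f ℓ odd n ⟨
    pentagonalSum f n n  ≡⟨ pentagonalSum-partitionParity n ≤-refl ⟩
    𝟙 n                  ∎
    where open ≡.≡-Reasoning

lemma3p2 : ((ℓ : ℕ) → 2 ≤ ℓ → ∃[ n ] (ℓ ≤ n × 2 * n ≤ ℓ * (3 * ℓ + 1) × 2 ∣ σmoex n))
           × ((m : ℕ) → ∃[ n ] (m ≤ n × 2 ∣ σmoex n))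
lemma3p2 = between , unbounded
  where
  between : (ℓ : ℕ) → 2 ≤ ℓ → ∃[ n ] (ℓ ≤ n × 2 * n ≤ ℓ * (3 * ℓ + 1) × 2 ∣ σmoex n)
  between ℓ 2≤ℓ with s , ℓ≤s , s≤pℓ , even ← even-partitions-between ℓ (≤-trans (s≤s z≤n) 2≤ℓ) =
    s , ℓ≤s , ≤-trans (*-monoʳ-≤ 2 s≤pℓ) (≤-reflexive (2*pentagonal ℓ))
      , parity≡0ℙ⇒2∣ (σmoex s) (≡.trans (parity-σmoex s) even)
  unbounded : (m : ℕ) → ∃[ n ] (m ≤ n × 2 ∣ σmoex n)
  unbounded m with n , m+2≤n , _ , 2∣σmoex ← between (m + 2) (m≤n+m 2 m) = n , ≤-trans (m≤m+n m 2) m+2≤n , 2∣σmoex
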